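{- Define integers $\alpha(i,j)$ for $i\geq 1$, $0\leq j\leq i$ by $\alpha(i,0)=0$, $\alpha(i,i)=1$, and $\alpha(i,j)=\sum_{k=j-1}^{i-1}\alpha(i-1,k)$ for $1\leq j<i$. Then $\alpha(i,j)\leq\binom{2i-j}{i}$ for all $1\leq j\leq i$. -}

module Defs where

open import Data.Nat using (ℕ; zero; suc; _+_; _∸_; _≟_; _<?_)
open import Data.List using (List; map)
open import Data.Nat.ListAction using (sum)
open import Data.List using (upTo)
open import Relation.Nullary using (yes; no)

-- Σ_{k=a}^{b} f k  (empty when b < a)
sumFromTo : ℕ → ℕ → (ℕ → ℕ) → ℕ
sumFromTo a b f = sum (map (λ t → f (a + t)) (upTo (suc b ∸ a)))

-- αp p j = α(p+1, j), the paper's α(i,j) with i = p+1 ≥ 1.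
-- Rules: α(i,0)=0, α(i,i)=1, α(i,j) = Σ_{k=j-1}^{i-1} α(i-1,k) for 1 ≤ j < i.
-- Values for j > i are irrelevant (set to 0) and never used by the recurrence.
αp : ℕ → ℕ → ℕ
αp p zero = 0
αp zero (suc j) with j ≟ 0
... | yes _ = 1
... | no _ = 0
αp (suc p) (suc j) with suc j ≟ suc (suc p) | suc j <? suc (suc p)
... | yes _ | _ = 1
... | no _ | yes _ = sumFromTo j (suc p) (λ k → αp p k)
... | no _ | no _ = 0

-- α(i,j) for i ≥ 1 (α 0 j is a junk value, never used)
α : ℕ → ℕ → ℕ
α zero j = 0
α (suc p) j = αp p j

module Submission where

-- Write β n k = C(2n − k, n) for the claimed bound, so that the theorem says
-- α(i, j) ≤ β i j.  The proof is an induction on i, and the bound is proved for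
-- every 0 ≤ j ≤ i (for j = 0 it holds trivially since α(i, 0) = 0).
--
-- The heart of the argument is that β satisfies the recurrence of α with
-- equality, by the hockey-stick identity
--     Σ_{k=j}^{n} C(2n − k, n) = C(2n + 1 − j, n + 1)        (j ≤ n),
-- proved by downward induction on j from Pascal's rule.  Hence, for 1 ≤ j < i,
--     α(i, j) = Σ_{k=j-1}^{i-1} α(i-1, k) ≤ Σ_{k=j-1}^{i-1} β(i-1, k) = β(i, j),
-- using the induction hypothesis termwise; on the diagonal α(i, i) = 1 = β(i, i).

open import Defs
open import Data.Nat using (ℕ; zero; suc; _+_; _∸_; _≤_; z≤n; s≤s; _≟_; _<?_;
  _≤‴_; ≤‴-refl; ≤‴-step)
open import Data.Nat.Properties
open import Data.Nat.Combinatorics using (_C_; nCn≡1; nCk+nC[k+1]≡[n+1]C[k+1])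
open import Data.List using (map; upTo; applyUpTo)
open import Data.List.Properties using (map-upTo; map-∘; map-cong)
open import Data.Nat.ListAction using (sum)
open import Relation.Binary.PropositionalEquality
open import Relation.Nullary using (yes; no)

sumFromTo-first : ∀ (f : ℕ → ℕ) {j b} → j ≤ b →
                  sumFromTo j b f ≡ f j + sumFromTo (suc j) b f
sumFromTo-first f {j} {b} j≤b = begin
    sum (map (λ t → f (j + t)) (upTo (suc b ∸ j)))
  ≡⟨ cong (λ m → sum (map (λ t → f (j + t)) (upTo m))) (+-∸-assoc 1 j≤b) ⟩
    f (j + 0) + sum (map (λ t → f (j + t)) (applyUpTo suc m))
  ≡⟨ cong₂ _+_ (cong f (+-identityʳ j)) (cong sum tail-shift) ⟩
    f j + sumFromTo (suc j) b f
  ∎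
  where
  open ≡-Reasoning
  m : ℕ
  m = b ∸ j
  tail-shift : map (λ t → f (j + t)) (applyUpTo suc m) ≡ map (λ t → f (suc j + t)) (upTo m)
  tail-shift = begin
      map (λ t → f (j + t)) (applyUpTo suc m)
    ≡⟨ cong (map (λ t → f (j + t))) (sym (map-upTo suc m)) ⟩
      map (λ t → f (j + t)) (map suc (upTo m))
    ≡⟨ sym (map-∘ (upTo m)) ⟩
      map (λ t → f (j + suc t)) (upTo m)
    ≡⟨ map-cong (λ t → cong f (+-suc j t)) (upTo m) ⟩
      map (λ t → f (suc j + t)) (upTo m)
    ∎

sumFromTo-single : ∀ (f : ℕ → ℕ) b → sumFromTo b b f ≡ f b
sumFromTo-single f b = begin
    sumFromTo b b f
  ≡⟨ sumFromTo-first f ≤-refl ⟩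
    f b + sum (map (λ t → f (suc b + t)) (upTo (b ∸ b)))
  ≡⟨ cong (λ m → f b + sum (map (λ t → f (suc b + t)) (upTo m))) (n∸n≡0 b) ⟩
    f b + 0
  ≡⟨ +-identityʳ (f b) ⟩
    f b
  ∎
  where open ≡-Reasoning

sumFromTo-mono : ∀ (f g : ℕ → ℕ) {a b} → a ≤‴ b →
                 (∀ k → a ≤ k → k ≤ b → f k ≤ g k) →
                 sumFromTo a b f ≤ sumFromTo a b g
sumFromTo-mono f g {b = b} ≤‴-refl f≤g = begin
    sumFromTo b b f  ≡⟨ sumFromTo-single f b ⟩
    f b              ≤⟨ f≤g b ≤-refl ≤-refl ⟩
    g b              ≡⟨ sumFromTo-single g b ⟨
    sumFromTo b b g  ∎
  where open ≤-Reasoning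
sumFromTo-mono f g {a} {b} (≤‴-step a<b) f≤g = begin
    sumFromTo a b f                  ≡⟨ sumFromTo-first f a≤b ⟩
    f a + sumFromTo (suc a) b f      ≤⟨ +-mono-≤ (f≤g a ≤-refl a≤b) tail≤ ⟩
    g a + sumFromTo (suc a) b g      ≡⟨ sumFromTo-first g a≤b ⟨
    sumFromTo a b g                  ∎
  where
  open ≤-Reasoning
  a≤b : a ≤ b
  a≤b = ≤‴⇒≤ (≤‴-step a<b)
  tail≤ : sumFromTo (suc a) b f ≤ sumFromTo (suc a) b g
  tail≤ = sumFromTo-mono f g a<b (λ k a<k k≤b → f≤g k (<⇒≤ a<k) k≤b)

β : ℕ → ℕ → ℕ
β n k = (n + n ∸ k) C n

β-diagonal : ∀ n → β n n ≡ 1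
β-diagonal n = trans (cong (_C n) (m+n∸n≡m n n)) (nCn≡1 n)

double-suc-∸ : ∀ n j → suc n + suc n ∸ suc j ≡ suc (n + n) ∸ j
double-suc-∸ n j = cong (_∸ j) (+-suc n n)

β-pascal : ∀ {n j} → j ≤ n → β n j + β (suc n) (suc (suc j)) ≡ β (suc n) (suc j)
β-pascal {n} {j} j≤n = begin
    N C n + (suc n + suc n ∸ suc (suc j)) C suc n
  ≡⟨ cong (λ m → N C n + m C suc n) (double-suc-∸ n (suc j)) ⟩
    N C n + N C suc n
  ≡⟨ nCk+nC[k+1]≡[n+1]C[k+1] N n ⟩
    suc N C suc n
  ≡⟨ cong (_C suc n) (+-∸-assoc 1 (≤-trans j≤n (m≤m+n n n))) ⟨
    (suc (n + n) ∸ j) C suc n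
  ≡⟨ cong (_C suc n) (double-suc-∸ n j) ⟨
    β (suc n) (suc j)
  ∎
  where
  open ≡-Reasoning
  N : ℕ
  N = n + n ∸ j

hockey-stick : ∀ {j n} → j ≤‴ n → sumFromTo j n (β n) ≡ β (suc n) (suc j)
hockey-stick {n = n} ≤‴-refl = begin
    sumFromTo n n (β n)  ≡⟨ sumFromTo-single (β n) n ⟩
    β n n                ≡⟨ β-diagonal n ⟩
    1                    ≡⟨ β-diagonal (suc n) ⟨
    β (suc n) (suc n)    ∎
  where open ≡-Reasoning
hockey-stick {j} {n} (≤‴-step j<n) = begin
    sumFromTo j n (β n)                    ≡⟨ sumFromTo-first (β n) j≤n ⟩
    β n j + sumFromTo (suc j) n (β n)      ≡⟨ cong (β n j +_) (hockey-stick j<n) ⟩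
    β n j + β (suc n) (suc (suc j))        ≡⟨ β-pascal j≤n ⟩
    β (suc n) (suc j)                      ∎
  where
  open ≡-Reasoning
  j≤n : j ≤ n
  j≤n = ≤‴⇒≤ (≤‴-step j<n)

α-bound : ∀ p k → k ≤ suc p → αp p k ≤ β (suc p) k
α-bound p zero _ = z≤n
α-bound zero (suc zero) _ = ≤-refl
α-bound zero (suc (suc k)) (s≤s ())
α-bound (suc p) (suc k) _ with suc k ≟ suc (suc p) | suc k <? suc (suc p)
... | yes refl | _ = ≤-reflexive (sym (β-diagonal (suc (suc p))))
... | no _ | yes (s≤s k<i) = begin
    sumFromTo k (suc p) (αp p)           ≤⟨ sumFromTo-mono (αp p) (β (suc p)) k≤‴i termwise ⟩
    sumFromTo k (suc p) (β (suc p))      ≡⟨ hockey-stick k≤‴i ⟩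
    β (suc (suc p)) (suc k)              ∎
  where
  open ≤-Reasoning
  k≤‴i : k ≤‴ suc p
  k≤‴i = ≤⇒≤‴ (<⇒≤ k<i)
  termwise : ∀ m → k ≤ m → m ≤ suc p → αp p m ≤ β (suc p) m
  termwise m _ m≤i = α-bound p m m≤i
... | no _ | no _ = z≤n

lemma9 : ∀ (i j : ℕ) → 1 ≤ j → j ≤ i → α i j ≤ ((i + i) ∸ j) C i
lemma9 zero j _ _ = z≤n
lemma9 (suc p) j _ j≤i = α-bound p j j≤i
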